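{- For $m,n\in\mathbb{N}$ with $m+n$ odd, $$(-1)^nR(-m,-n)+(-1)^mR(-n,-m)=\frac{m!\,n!}{(m+n+1)!}.$$
   Context: For $m,n\in\mathbb{N}_0$ with $m+n$ odd, $R(-m,-n):=(-1)^n\frac{m!\,n!}{(m+n+1)!}+\sum_{k=1,\ k\ \text{even}}^{n}\binom{n}{k}\zeta(k-m-n)$, where $\zeta$ is the Riemann zeta function. -}

module Defs where

open import Data.Nat as ℕ using (ℕ; zero; suc)
open import Data.Nat.Combinatorics using (_C_)
open import Data.Nat.Base using (_!)
open import Data.Nat.Properties using (_!≢0)
open import Data.Integer as ℤ using (ℤ; +_)
open import Data.Rational using (ℚ; _/_; _+_; _*_; -_; 0ℚ; 1ℚ)
open import Data.Bool using (if_then_else_)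

sgn : ℕ → ℚ
sgn zero = 1ℚ
sgn (suc n) = - sgn n

fromℕ : ℕ → ℚ
fromℕ n = (+ n) / 1

Σ< : ℕ → (ℕ → ℚ) → ℚ
Σ< zero f = 0ℚ
Σ< (suc n) f = Σ< n f + f n

-- Bernoulli numbers with the convention B₁ = -1/2, defined by the
-- standard recurrence  B₀ = 1,  B_n = -(1/(n+1)) Σ_{k<n} C(n+1,k) B_k.
-- bernTable n returns the function k ↦ B_k valid for k ≤ n.
bernTable : ℕ → (ℕ → ℚ)
bernTable zero k = 1ℚ
bernTable (suc n) k with k ℕ.≤ᵇ n
... | Data.Bool.true = bernTable n k
... | Data.Bool.false =
  - ((+ 1 / suc (suc n)) * Σ< (suc n) (λ j → fromℕ ((suc (suc n)) C j) * bernTable n j))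

bernoulli : ℕ → ℚ
bernoulli n = bernTable n n

-- Values of the Riemann zeta function at non-positive integers:
-- ζ(-j) = (-1)^j B_{j+1} / (j+1)   (so ζ(0) = -1/2, ζ(-1) = -1/12, ζ(-2k) = 0).
ζneg : ℕ → ℚ
ζneg j = sgn j * bernoulli (suc j) * (+ 1 / suc j)

even? : ℕ → Data.Bool.Bool
even? zero = Data.Bool.true
even? (suc zero) = Data.Bool.false
even? (suc (suc n)) = even? n

betaQ : ℕ → ℕ → ℚ
betaQ m n = ((+ (m ! ℕ.* n !)) / (suc (m ℕ.+ n)) !) {{(suc (m ℕ.+ n)) !≢0}}

-- R(-m,-n) = (-1)^n m! n!/(m+n+1)! + Σ_{1≤k≤n, k even} C(n,k) ζ(k-m-n)
-- (for k ≤ n, k - m - n = -(m + n - k) ≤ 0).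
R : ℕ → ℕ → ℚ
R m n = sgn n * betaQ m n
      + Σ< n (λ i → let k = suc i in
             if even? k then fromℕ (n C k) * ζneg (m ℕ.+ n ℕ.∸ k) else 0ℚ)

{-# OPTIONS --safe #-}
module Submission where

-- Write B′ j = B_{j+1}/(j+1), so that ζ(-j) = (-1)^j B′ j, and A a b = Σ_{k≤a} C(a,k) B′(b+k).
-- The heart of the proof is the identity
--   Δ a b = (-1)^a A a b + (-1)^b A b a + (-1)^(a+b) β(a,b) = 0   for all a, b,
-- where β(a,b) = a! b!/(a+b+1)!.
-- Δ is symmetric; Pascal's rule for A together with β(a+1,b) + β(a,b+1) = β(a,b) gives
-- Δ(a+1,b) = -(Δ(a,b) + Δ(a,b+1)); and the Bernoulli recurrence gives
-- Δ(0,b) = (1 + (-1)^b) B′ b for b ≥ 1, which vanishes for odd b.  These facts force Δ = 0.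
-- Read at (0,b) with b even, Δ = 0 also yields B_{b+1} = 0.  Hence, for m + n odd and m ≥ 1,
-- every summand of the zeta sum in R(-m,-n) is -C(n,k) B′(m+n-k), the sum is B′(m+n) - A n m,
-- and the theorem reduces to Δ m n = 0.

open import Defs
open import Data.Nat using (ℕ; NonZero; _%_)
open import Data.Rational using (_+_; _*_)
open import Relation.Binary.PropositionalEquality using (_≡_)

open import Data.Bool using (true; false; not; if_then_else_; T)
open import Data.Empty using (⊥-elim)
open import Data.Sum using (inj₁; inj₂)
open import Data.Unit using (tt)
open import Data.Bool.Properties using (not-injective)
open import Data.Nat as ℕ using (zero; suc; _≤_; _<_; _!)
import Data.Nat.Properties as ℕₚ
open import Algebra.Properties.CommutativeSemigroup ℕₚ.+-commutativeSemigroup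
  using (x∙yz≈y∙xz)
open import Data.Nat.Combinatorics
  using (_C_; nCk+nC[k+1]≡[n+1]C[k+1]; k>n⇒nCk≡0; nCk≡nC[n∸k]; nC1≡n; nCn≡1)
open import Data.Nat.DivMod using ([m+n]%n≡m%n)
open import Data.Nat.Tactic.RingSolver using (solve-∀)
open import Data.Integer as ℤ using (+_)
import Data.Integer.Properties as ℤₚ
open import Data.Rational using (ℚ; _/_; -_; _-_; 0ℚ; 1ℚ; toℚᵘ)
import Data.Rational.Properties as ℚₚ
open import Data.Rational.Unnormalised as ℚᵘ using (mkℚᵘ; *≡*)
import Data.Rational.Unnormalised.Properties as ℚᵘₚ
open import Data.Rational.Solver renaming (module +-*-Solver to ℚ-Solver)
open import Relation.Nullary using (contradiction)
open import Relation.Binary.PropositionalEquality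
  using (refl; sym; trans; cong; cong₂; subst; module ≡-Reasoning)

open ℚ-Solver using (solve; _:+_; _:-_; _:*_; :-_; _:=_; con)

toℚᵘ-n/d : ∀ n d → toℚᵘ (+ n / suc d) ℚᵘ.≃ mkℚᵘ (+ n) d
toℚᵘ-n/d n d = ℚₚ.toℚᵘ-fromℚᵘ (mkℚᵘ (+ n) d)

/-cross : ∀ m n d e .{{_ : NonZero d}} .{{_ : NonZero e}} →
          m ℕ.* e ≡ n ℕ.* d → + m / d ≡ + n / e
/-cross m n zero    _       _ = contradiction refl (ℕ.≢-nonZero⁻¹ 0)
/-cross m n (suc _) zero    _ = contradiction refl (ℕ.≢-nonZero⁻¹ 0)
/-cross m n (suc d) (suc e) eq = ℚₚ.fromℚᵘ-cong {mkℚᵘ (+ m) d} {mkℚᵘ (+ n) e}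
  (*≡* (trans (sym (ℤₚ.pos-* m (suc e))) (trans (cong +_ eq) (ℤₚ.pos-* n (suc d)))))

n/d≡n*1/d : ∀ n d .{{_ : NonZero d}} → + n / d ≡ fromℕ n * (+ 1 / d)
n/d≡n*1/d n zero    = contradiction refl (ℕ.≢-nonZero⁻¹ 0)
n/d≡n*1/d n (suc d) =
  ℚₚ.toℚᵘ-injective (ℚᵘₚ.≃-trans (toℚᵘ-n/d n d) (ℚᵘₚ.≃-sym (begin
    toℚᵘ (fromℕ n * (+ 1 / suc d))
      ≈⟨ ℚₚ.toℚᵘ-homo-* (fromℕ n) (+ 1 / suc d) ⟩
    toℚᵘ (fromℕ n) ℚᵘ.* toℚᵘ (+ 1 / suc d)
      ≈⟨ ℚᵘₚ.*-cong (toℚᵘ-n/d n 0) (toℚᵘ-n/d 1 d) ⟩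
    mkℚᵘ (+ n ℤ.* + 1) (d ℕ.+ 0)
      ≡⟨ cong₂ mkℚᵘ (ℤₚ.*-identityʳ (+ n)) (ℕₚ.+-identityʳ d) ⟩
    mkℚᵘ (+ n) d ∎)))
  where open ℚᵘₚ.≃-Reasoning

fromℕ-homo-+ : ∀ m n → fromℕ (m ℕ.+ n) ≡ fromℕ m + fromℕ n
fromℕ-homo-+ m n =
  ℚₚ.toℚᵘ-injective (ℚᵘₚ.≃-trans (toℚᵘ-n/d (m ℕ.+ n) 0) (ℚᵘₚ.≃-sym (begin
    toℚᵘ (fromℕ m + fromℕ n)
      ≈⟨ ℚₚ.toℚᵘ-homo-+ (fromℕ m) (fromℕ n) ⟩
    toℚᵘ (fromℕ m) ℚᵘ.+ toℚᵘ (fromℕ n)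
      ≈⟨ ℚᵘₚ.+-cong (toℚᵘ-n/d m 0) (toℚᵘ-n/d n 0) ⟩
    mkℚᵘ (+ m ℤ.* + 1 ℤ.+ + n ℤ.* + 1) 0
      ≡⟨ cong (λ k → mkℚᵘ k 0) (cong₂ ℤ._+_ (ℤₚ.*-identityʳ (+ m)) (ℤₚ.*-identityʳ (+ n))) ⟩
    mkℚᵘ (+ m ℤ.+ + n) 0
      ≡⟨ cong (λ k → mkℚᵘ k 0) (ℤₚ.pos-+ m n) ⟨
    mkℚᵘ (+ (m ℕ.+ n)) 0 ∎)))
  where open ℚᵘₚ.≃-Reasoning

open ≡-Reasoning

n*1/n≡1 : ∀ n .{{_ : NonZero n}} → fromℕ n * (+ 1 / n) ≡ 1ℚ
n*1/n≡1 n = trans (sym (n/d≡n*1/d n n)) (/-cross n 1 n 1 (ℕₚ.*-comm n 1))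

p*q≡0⇒q≡0 : ∀ p {p′ q} → p * p′ ≡ 1ℚ → p * q ≡ 0ℚ → q ≡ 0ℚ
p*q≡0⇒q≡0 p {p′} {q} pp′≡1 pq≡0 = begin
  q              ≡⟨ ℚₚ.*-identityˡ q ⟨
  1ℚ * q         ≡⟨ cong (_* q) pp′≡1 ⟨
  p * p′ * q     ≡⟨ solve 3 (λ p p′ q → p :* p′ :* q := p′ :* (p :* q)) refl p p′ q ⟩
  p′ * (p * q)   ≡⟨ cong (p′ *_) pq≡0 ⟩
  p′ * 0ℚ        ≡⟨ ℚₚ.*-zeroʳ p′ ⟩
  0ℚ             ∎

Σ<-cong : ∀ n {f g : ℕ → ℚ} → (∀ i → i < n → f i ≡ g i) → Σ< n f ≡ Σ< n g
Σ<-cong zero    f≗g = refl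
Σ<-cong (suc n) f≗g =
  cong₂ _+_ (Σ<-cong n (λ i i<n → f≗g i (ℕₚ.m<n⇒m<1+n i<n))) (f≗g n (ℕₚ.n<1+n n))

Σ<-distrib-+ : ∀ n (f g : ℕ → ℚ) → Σ< n (λ i → f i + g i) ≡ Σ< n f + Σ< n g
Σ<-distrib-+ zero    f g = refl
Σ<-distrib-+ (suc n) f g = trans (cong (_+ (f n + g n)) (Σ<-distrib-+ n f g))
  (solve 4 (λ F G x y → (F :+ G) :+ (x :+ y) := (F :+ x) :+ (G :+ y))
         refl (Σ< n f) (Σ< n g) (f n) (g n))

Σ<-distribˡ-* : ∀ n c (f : ℕ → ℚ) → Σ< n (λ i → c * f i) ≡ c * Σ< n f
Σ<-distribˡ-* zero    c f = sym (ℚₚ.*-zeroʳ c)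
Σ<-distribˡ-* (suc n) c f =
  trans (cong (_+ (c * f n)) (Σ<-distribˡ-* n c f)) (sym (ℚₚ.*-distribˡ-+ c (Σ< n f) (f n)))

Σ<-neg : ∀ n (f : ℕ → ℚ) → Σ< n (λ i → - f i) ≡ - Σ< n f
Σ<-neg zero    f = refl
Σ<-neg (suc n) f = trans (cong (_- f n) (Σ<-neg n f)) (sym (ℚₚ.neg-distrib-+ (Σ< n f) (f n)))

Σ<-head : ∀ n (f : ℕ → ℚ) → Σ< (suc n) f ≡ f 0 + Σ< n (λ i → f (suc i))
Σ<-head zero    f = trans (ℚₚ.+-identityˡ (f 0)) (sym (ℚₚ.+-identityʳ (f 0)))
Σ<-head (suc n) f = trans (cong (_+ f (suc n)) (Σ<-head n f)) (ℚₚ.+-assoc (f 0) _ _)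

Σ<-reverse : ∀ n (f : ℕ → ℚ) → Σ< n f ≡ Σ< n (λ i → f (n ℕ.∸ suc i))
Σ<-reverse zero    f = refl
Σ<-reverse (suc n) f = begin
  Σ< n f + f n                         ≡⟨ cong (_+ f n) (Σ<-reverse n f) ⟩
  Σ< n (λ i → f (n ℕ.∸ suc i)) + f n   ≡⟨ ℚₚ.+-comm _ (f n) ⟩
  f n + Σ< n (λ i → f (n ℕ.∸ suc i))   ≡⟨ Σ<-head n (λ i → f (n ℕ.∸ i)) ⟨
  Σ< (suc n) (λ i → f (n ℕ.∸ i))       ∎

even?-suc : ∀ n → even? (suc n) ≡ not (even? n)
even?-suc zero          = refl
even?-suc (suc zero)    = refl
even?-suc (suc (suc n)) = even?-suc n

even?-+ : ∀ m n → even? (m ℕ.+ n) ≡ (if even? m then even? n else not (even? n))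
even?-+ zero          n = refl
even?-+ (suc zero)    n = even?-suc n
even?-+ (suc (suc m)) n = even?-+ m n

n%2≡1⇒odd : ∀ n → n % 2 ≡ 1 → even? n ≡ false
n%2≡1⇒odd zero          ()
n%2≡1⇒odd (suc zero)    _  = refl
n%2≡1⇒odd (suc (suc n)) eq =
  n%2≡1⇒odd n (trans (sym ([m+n]%n≡m%n n 2)) (trans (cong (_% 2) (ℕₚ.+-comm n 2)) eq))

sgn-suc-suc : ∀ n → sgn (suc (suc n)) ≡ sgn n
sgn-suc-suc n = solve 1 (λ s → :- (:- s) := s) refl (sgn n)

sgn-even : ∀ n → even? n ≡ true → sgn n ≡ 1ℚ
sgn-even zero          _    = refl
sgn-even (suc (suc n)) even = trans (sgn-suc-suc n) (sgn-even n even)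

sgn-odd : ∀ n → even? n ≡ false → sgn n ≡ - 1ℚ
sgn-odd (suc zero)    _   = refl
sgn-odd (suc (suc n)) odd = trans (sgn-suc-suc n) (sgn-odd n odd)

sgn*sgn≡1 : ∀ n → sgn n * sgn n ≡ 1ℚ
sgn*sgn≡1 zero    = refl
sgn*sgn≡1 (suc n) = trans (solve 1 (λ s → (:- s) :* (:- s) := s :* s) refl (sgn n)) (sgn*sgn≡1 n)

sgn-+-odd : ∀ m n → even? (m ℕ.+ n) ≡ false → sgn m + sgn n ≡ 0ℚ
sgn-+-odd m n odd with even? m in m-parity | even?-+ m n
... | true  | m+n-parity = cong₂ _+_ (sgn-even m m-parity) (sgn-odd n (trans (sym m+n-parity) odd))
... | false | m+n-parity =
  cong₂ _+_ (sgn-odd m m-parity) (sgn-even n (not-injective (trans (sym m+n-parity) odd)))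

[k+1]*[n+1]C[k+1]≡[n+1]*nCk : ∀ n k → suc k ℕ.* (suc n C suc k) ≡ suc n ℕ.* (n C k)
[k+1]*[n+1]C[k+1]≡[n+1]*nCk zero    zero    = refl
[k+1]*[n+1]C[k+1]≡[n+1]*nCk zero    (suc k) = ℕₚ.*-zeroʳ (suc (suc k))
[k+1]*[n+1]C[k+1]≡[n+1]*nCk (suc n) zero    = begin
  1 ℕ.* (suc (suc n) C 1)            ≡⟨ ℕₚ.*-identityˡ _ ⟩
  suc (suc n) C 1                    ≡⟨ nC1≡n (suc (suc n)) ⟩
  suc (suc n)                        ≡⟨ ℕₚ.*-identityʳ (suc (suc n)) ⟨
  suc (suc n) ℕ.* 1                  ∎
[k+1]*[n+1]C[k+1]≡[n+1]*nCk (suc n) (suc k) = begin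
  (2 ℕ.+ k) ℕ.* (suc (suc n) C suc (suc k))
    ≡⟨ cong ((2 ℕ.+ k) ℕ.*_) (nCk+nC[k+1]≡[n+1]C[k+1] (suc n) (suc k)) ⟨
  (2 ℕ.+ k) ℕ.* (x ℕ.+ y)
    ≡⟨ regroup k x y ⟩
  ((1 ℕ.+ k) ℕ.* x ℕ.+ (2 ℕ.+ k) ℕ.* y) ℕ.+ x
    ≡⟨ cong₂ (λ p q → (p ℕ.+ q) ℕ.+ x)
             ([k+1]*[n+1]C[k+1]≡[n+1]*nCk n k) ([k+1]*[n+1]C[k+1]≡[n+1]*nCk n (suc k)) ⟩
  ((1 ℕ.+ n) ℕ.* (n C k) ℕ.+ (1 ℕ.+ n) ℕ.* (n C suc k)) ℕ.+ x
    ≡⟨ cong (ℕ._+ x) (ℕₚ.*-distribˡ-+ (1 ℕ.+ n) (n C k) (n C suc k)) ⟨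
  (1 ℕ.+ n) ℕ.* (n C k ℕ.+ n C suc k) ℕ.+ x
    ≡⟨ cong (λ t → (1 ℕ.+ n) ℕ.* t ℕ.+ x) (nCk+nC[k+1]≡[n+1]C[k+1] n k) ⟩
  (1 ℕ.+ n) ℕ.* x ℕ.+ x
    ≡⟨ ℕₚ.+-comm ((1 ℕ.+ n) ℕ.* x) x ⟩
  (2 ℕ.+ n) ℕ.* x ∎
  where
  regroup : ∀ k x y → (2 ℕ.+ k) ℕ.* (x ℕ.+ y) ≡ ((1 ℕ.+ k) ℕ.* x ℕ.+ (2 ℕ.+ k) ℕ.* y) ℕ.+ x
  regroup = solve-∀
  x = suc n C suc k
  y = suc n C suc (suc k)

nCk/[k+1]≡[n+1]C[k+1]/[n+1] : ∀ n k →
  fromℕ (n C k) * (+ 1 / suc k) ≡ fromℕ (suc n C suc k) * (+ 1 / suc n)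
nCk/[k+1]≡[n+1]C[k+1]/[n+1] n k = begin
  fromℕ (n C k) * (+ 1 / suc k)              ≡⟨ n/d≡n*1/d (n C k) (suc k) ⟨
  + (n C k) / suc k                          ≡⟨ /-cross (n C k) (suc n C suc k) (suc k) (suc n) absorption ⟩
  + (suc n C suc k) / suc n                  ≡⟨ n/d≡n*1/d (suc n C suc k) (suc n) ⟩
  fromℕ (suc n C suc k) * (+ 1 / suc n)      ∎
  where
  absorption : (n C k) ℕ.* suc n ≡ (suc n C suc k) ℕ.* suc k
  absorption = trans (ℕₚ.*-comm (n C k) (suc n))
    (trans (sym ([k+1]*[n+1]C[k+1]≡[n+1]*nCk n k)) (ℕₚ.*-comm (suc k) (suc n C suc k)))

bernTable-stable : ∀ n k → k ≤ n → bernTable n k ≡ bernoulli k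
bernTable-stable zero    zero ℕ.z≤n = refl
bernTable-stable (suc n) k    k≤1+n with ℕₚ.m≤n⇒m<n∨m≡n k≤1+n
... | inj₂ refl = refl
... | inj₁ k<1+n with k ℕ.≤ᵇ n in k≤ᵇn
...   | true  = bernTable-stable n k (ℕₚ.≤-pred k<1+n)
...   | false = ⊥-elim (subst T k≤ᵇn (ℕₚ.≤⇒≤ᵇ (ℕₚ.≤-pred k<1+n)))

bernoulli-suc : ∀ n → bernoulli (suc n) ≡
  - (+ 1 / suc (suc n) * Σ< (suc n) (λ j → fromℕ (suc (suc n) C j) * bernoulli j))
bernoulli-suc n with suc n ℕ.≤ᵇ n in 1+n≤ᵇn
... | true  = ⊥-elim (ℕₚ.n≮n n (ℕₚ.≤ᵇ⇒≤ (suc n) n (subst T (sym 1+n≤ᵇn) tt)))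
... | false = cong (λ s → - (+ 1 / suc (suc n) * s)) (Σ<-cong (suc n) (λ j j<1+n →
    cong (fromℕ (suc (suc n) C j) *_) (bernTable-stable n j (ℕₚ.≤-pred j<1+n))))

bernoulli-recurrence : ∀ n → Σ< (suc (suc n)) (λ j → fromℕ (suc (suc n) C j) * bernoulli j) ≡ 0ℚ
bernoulli-recurrence n = begin
  S + fromℕ (suc (suc n) C suc n) * bernoulli (suc n)
    ≡⟨ cong₂ (λ c b → S + fromℕ c * b) [n+2]C[n+1]≡n+2 (bernoulli-suc n) ⟩
  S + fromℕ (suc (suc n)) * (- (U * S))
    ≡⟨ solve 3 (λ s d u → s :+ d :* (:- (u :* s)) := s :- (d :* u) :* s) refl S (fromℕ (suc (suc n))) U ⟩
  S - fromℕ (suc (suc n)) * U * S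
    ≡⟨ cong (λ t → S - t * S) (n*1/n≡1 (suc (suc n))) ⟩
  S - 1ℚ * S
    ≡⟨ solve 1 (λ s → s :- con 1ℚ :* s := con 0ℚ) refl S ⟩
  0ℚ ∎
  where
  S = Σ< (suc n) (λ j → fromℕ (suc (suc n) C j) * bernoulli j)
  U = + 1 / suc (suc n)
  [n+2]C[n+1]≡n+2 : suc (suc n) C suc n ≡ suc (suc n)
  [n+2]C[n+1]≡n+2 = trans (nCk≡nC[n∸k] (ℕₚ.n≤1+n (suc n)))
    (trans (cong (suc (suc n) C_) (ℕₚ.m+n∸n≡m 1 (suc n))) (nC1≡n (suc (suc n))))

binomialSum : (ℕ → ℚ) → ℕ → ℕ → ℚ
binomialSum f a b = Σ< (suc a) (λ k → fromℕ (a C k) * f (b ℕ.+ k))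

binomialSum-zero : ∀ f b → binomialSum f 0 b ≡ f b
binomialSum-zero f b = trans (ℚₚ.+-identityˡ _)
  (trans (ℚₚ.*-identityˡ (f (b ℕ.+ 0))) (cong f (ℕₚ.+-identityʳ b)))

binomialSum-suc : ∀ f a b → binomialSum f (suc a) b ≡ binomialSum f a b + binomialSum f a (suc b)
binomialSum-suc f a b = begin
  binomialSum f (suc a) b
    ≡⟨ Σ<-head (suc a) _ ⟩
  f₀ + Σ< (suc a) (λ i → fromℕ (suc a C suc i) * g i)
    ≡⟨ cong (_+_ f₀) (Σ<-cong (suc a) (λ i _ → pascal i)) ⟩
  f₀ + Σ< (suc a) (λ i → fromℕ (a C i) * g i + fromℕ (a C suc i) * g i)
    ≡⟨ cong (_+_ f₀) (Σ<-distrib-+ (suc a) _ _) ⟩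
  f₀ + (Σ< (suc a) (λ i → fromℕ (a C i) * g i) + (rest + fromℕ (a C suc a) * g a))
    ≡⟨ cong₂ (λ s c → f₀ + (s + (rest + fromℕ c * g a)))
             (Σ<-cong (suc a) (λ i _ → shift i)) (k>n⇒nCk≡0 (ℕₚ.n<1+n a)) ⟩
  f₀ + (binomialSum f a (suc b) + (rest + 0ℚ * g a))
    ≡⟨ solve 4 (λ x y t z → x :+ (y :+ (t :+ con 0ℚ :* z)) := (x :+ t) :+ y)
             refl f₀ (binomialSum f a (suc b)) rest (g a) ⟩
  (f₀ + rest) + binomialSum f a (suc b)
    ≡⟨ cong (_+ binomialSum f a (suc b)) (Σ<-head a _) ⟨
  binomialSum f a b + binomialSum f a (suc b) ∎
  where
  g : ℕ → ℚ
  g i = f (b ℕ.+ suc i)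
  f₀ = fromℕ 1 * f (b ℕ.+ 0)
  rest = Σ< a (λ i → fromℕ (a C suc i) * g i)
  pascal : ∀ i → fromℕ (suc a C suc i) * g i ≡ fromℕ (a C i) * g i + fromℕ (a C suc i) * g i
  pascal i = begin
    fromℕ (suc a C suc i) * g i
      ≡⟨ cong (λ c → fromℕ c * g i) (nCk+nC[k+1]≡[n+1]C[k+1] a i) ⟨
    fromℕ (a C i ℕ.+ a C suc i) * g i
      ≡⟨ cong (_* g i) (fromℕ-homo-+ (a C i) (a C suc i)) ⟩
    (fromℕ (a C i) + fromℕ (a C suc i)) * g i
      ≡⟨ ℚₚ.*-distribʳ-+ (g i) (fromℕ (a C i)) (fromℕ (a C suc i)) ⟩
    fromℕ (a C i) * g i + fromℕ (a C suc i) * g i ∎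
  shift : ∀ i → fromℕ (a C i) * g i ≡ fromℕ (a C i) * f (suc b ℕ.+ i)
  shift i = cong (λ j → fromℕ (a C i) * f j) (ℕₚ.+-suc b i)

binomialSum-reverse : ∀ f a b →
  binomialSum f a b ≡ Σ< (suc a) (λ k → fromℕ (a C k) * f (b ℕ.+ a ℕ.∸ k))
binomialSum-reverse f a b = trans (Σ<-reverse (suc a) _) (Σ<-cong (suc a) (λ k k<1+a →
  let k≤a = ℕₚ.≤-pred k<1+a in
  cong₂ (λ c j → fromℕ c * f j) (sym (nCk≡nC[n∸k] k≤a)) (sym (ℕₚ.+-∸-assoc b k≤a))))

B′ : ℕ → ℚ
B′ j = bernoulli (suc j) * (+ 1 / suc j)

ζneg≡sgn*B′ : ∀ j → ζneg j ≡ sgn j * B′ j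
ζneg≡sgn*B′ j = ℚₚ.*-assoc (sgn j) (bernoulli (suc j)) (+ 1 / suc j)

binomialSum-B′-suc-0 : ∀ n → binomialSum B′ (suc n) 0 ≡ B′ (suc n) - + 1 / suc (suc n)
binomialSum-B′-suc-0 n = begin
  binomialSum B′ b 0
    ≡⟨ Σ<-cong (suc b) (λ k _ → absorb k) ⟩
  Σ< (suc b) (λ k → U * c k)
    ≡⟨ Σ<-distribˡ-* (suc b) U c ⟩
  U * Σ< (suc b) c
    ≡⟨ cong (U *_) shifted-recurrence ⟩
  U * (bernoulli (suc b) - 1ℚ)
    ≡⟨ solve 2 (λ u x → u :* (x :- con 1ℚ) := x :* u :- u) refl U (bernoulli (suc b)) ⟩
  B′ b - U ∎
  where
  b = suc n
  U = + 1 / suc b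
  c : ℕ → ℚ
  c k = fromℕ (suc b C suc k) * bernoulli (suc k)
  absorb : ∀ k → fromℕ (b C k) * B′ k ≡ U * c k
  absorb k = begin
    fromℕ (b C k) * (bernoulli (suc k) * (+ 1 / suc k))
      ≡⟨ solve 3 (λ c x u → c :* (x :* u) := x :* (c :* u)) refl (fromℕ (b C k)) (bernoulli (suc k)) (+ 1 / suc k) ⟩
    bernoulli (suc k) * (fromℕ (b C k) * (+ 1 / suc k))
      ≡⟨ cong (bernoulli (suc k) *_) (nCk/[k+1]≡[n+1]C[k+1]/[n+1] b k) ⟩
    bernoulli (suc k) * (fromℕ (suc b C suc k) * U)
      ≡⟨ solve 3 (λ x c u → x :* (c :* u) := u :* (c :* x)) refl (bernoulli (suc k)) (fromℕ (suc b C suc k)) U ⟩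
    U * c k ∎
  shifted-recurrence : Σ< (suc b) c ≡ bernoulli (suc b) - 1ℚ
  shifted-recurrence = begin
    Σ< (suc b) c
      ≡⟨ solve 1 (λ t → t := (con 1ℚ :* con 1ℚ :+ t) :- con 1ℚ) refl (Σ< (suc b) c) ⟩
    (fromℕ (suc b C 0) * bernoulli 0 + Σ< (suc b) c) - 1ℚ
      ≡⟨ cong (_- 1ℚ) (Σ<-head (suc b) (λ j → fromℕ (suc b C j) * bernoulli j)) ⟨
    (Σ< (suc b) (λ j → fromℕ (suc b C j) * bernoulli j) + fromℕ (suc b C suc b) * bernoulli (suc b)) - 1ℚ
      ≡⟨ cong₂ (λ s c → (s + fromℕ c * bernoulli (suc b)) - 1ℚ) (bernoulli-recurrence n) (nCn≡1 (suc b)) ⟩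
    (0ℚ + 1ℚ * bernoulli (suc b)) - 1ℚ
      ≡⟨ solve 1 (λ x → (con 0ℚ :+ con 1ℚ :* x) :- con 1ℚ := x :- con 1ℚ) refl (bernoulli (suc b)) ⟩
    bernoulli (suc b) - 1ℚ ∎

betaQ-comm : ∀ a b → betaQ a b ≡ betaQ b a
betaQ-comm a b =
  /-cross (a ! ℕ.* b !) (b ! ℕ.* a !) (suc (a ℕ.+ b) !) (suc (b ℕ.+ a) !)
          {{suc (a ℕ.+ b) ℕₚ.!≢0}} {{suc (b ℕ.+ a) ℕₚ.!≢0}}
          (cong₂ (λ p s → p ℕ.* suc s !) (ℕₚ.*-comm (a !) (b !)) (ℕₚ.+-comm b a))

betaQ-0 : ∀ b → betaQ 0 b ≡ + 1 / suc b
betaQ-0 b = /-cross (1 ℕ.* b !) 1 (suc b !) (suc b) {{suc b ℕₚ.!≢0}} (reorder (b !) b)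
  where
  reorder : ∀ f b → (1 ℕ.* f) ℕ.* suc b ≡ 1 ℕ.* (suc b ℕ.* f)
  reorder = solve-∀

betaQ-pascal : ∀ a b → betaQ (suc a) b + betaQ a (suc b) ≡ betaQ a b
betaQ-pascal a b = begin
  betaQ (suc a) b + betaQ a (suc b)
    ≡⟨ cong₂ _+_ (n/d≡n*1/d p (suc s′ !) {{suc s′ ℕₚ.!≢0}})
                 (trans (n/d≡n*1/d q _ {{suc (a ℕ.+ suc b) ℕₚ.!≢0}})
                        (cong (λ t → fromℕ q * 1/[1+ t ]!) (ℕₚ.+-suc a b))) ⟩
  fromℕ p * 1/[1+ s′ ]! + fromℕ q * 1/[1+ s′ ]!
    ≡⟨ ℚₚ.*-distribʳ-+ 1/[1+ s′ ]! (fromℕ p) (fromℕ q) ⟨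
  (fromℕ p + fromℕ q) * 1/[1+ s′ ]!
    ≡⟨ cong (_* 1/[1+ s′ ]!) (fromℕ-homo-+ p q) ⟨
  fromℕ (p ℕ.+ q) * 1/[1+ s′ ]!
    ≡⟨ n/d≡n*1/d (p ℕ.+ q) (suc s′ !) {{suc s′ ℕₚ.!≢0}} ⟨
  (+ (p ℕ.+ q) / suc s′ !) {{suc s′ ℕₚ.!≢0}}
    ≡⟨ /-cross (p ℕ.+ q) (a ! ℕ.* b !) (suc s′ !) (suc s !) {{suc s′ ℕₚ.!≢0}} {{suc s ℕₚ.!≢0}}
               (reorder a b (a !) (b !) (suc s !)) ⟩
  betaQ a b ∎
  where
  s  = a ℕ.+ b
  s′ = suc s
  p  = suc a ! ℕ.* b !
  q  = a ! ℕ.* suc b !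
  1/[1+_]! : ℕ → ℚ
  1/[1+ t ]! = (+ 1 / suc t !) {{suc t ℕₚ.!≢0}}
  reorder : ∀ a b fa fb f → ((1 ℕ.+ a) ℕ.* fa ℕ.* fb ℕ.+ fa ℕ.* ((1 ℕ.+ b) ℕ.* fb)) ℕ.* f
                            ≡ fa ℕ.* fb ℕ.* ((2 ℕ.+ (a ℕ.+ b)) ℕ.* f)
  reorder = solve-∀

-- Induction over the lines a + b = s.  Odd lines follow from the boundary values.  If d
-- vanishes on line s - 1 and s is even, the recurrence gives d a b = (-1)^a x on line s and
-- d a b = (-1)^a a x on line s + 1, where x = d 0 s; at the end (s+1, 0) of line s + 1,
-- symmetry and the boundary give (s+1) x = 0.
module AntiDiagonal (d : ℕ → ℕ → ℚ)
  (d-suc : ∀ a b → d (suc a) b ≡ - (d a b + d a (suc b)))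
  (d-comm : ∀ a b → d a b ≡ d b a)
  (d-0-odd : ∀ b → even? b ≡ false → d 0 b ≡ 0ℚ) where

  VanishesOn : ℕ → Set
  VanishesOn s = ∀ a b → a ℕ.+ b ≡ s → d a b ≡ 0ℚ

  VanishesBefore : ℕ → Set
  VanishesBefore s = ∀ a b → suc (a ℕ.+ b) ≡ s → d a b ≡ 0ℚ

  odd-line : ∀ s → even? s ≡ false → VanishesBefore s → VanishesOn s
  odd-line s odd before zero    b refl = d-0-odd b odd
  odd-line s odd before (suc a) b eq   = begin
    d (suc a) b
      ≡⟨ d-suc a b ⟩
    - (d a b + d a (suc b))
      ≡⟨ cong₂ (λ p q → - (p + q)) (before a b eq) (odd-line s odd before a (suc b) (trans (ℕₚ.+-suc a b) eq)) ⟩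
    - (0ℚ + 0ℚ)
      ≡⟨⟩
    0ℚ ∎

  even-line : ∀ s → even? s ≡ true → VanishesBefore s → VanishesOn s
  even-line s even before a b eq = begin
    d a b        ≡⟨ on-line a b eq ⟩
    sgn a * x    ≡⟨ cong (sgn a *_) x≡0 ⟩
    sgn a * 0ℚ   ≡⟨ ℚₚ.*-zeroʳ (sgn a) ⟩
    0ℚ           ∎
    where
    x = d 0 s

    on-line : ∀ a b → a ℕ.+ b ≡ s → d a b ≡ sgn a * x
    on-line zero    b refl = sym (ℚₚ.*-identityˡ x)
    on-line (suc a) b eq   = begin
      d (suc a) b
        ≡⟨ d-suc a b ⟩
      - (d a b + d a (suc b))
        ≡⟨ cong₂ (λ p q → - (p + q)) (before a b eq) (on-line a (suc b) (trans (ℕₚ.+-suc a b) eq)) ⟩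
      - (0ℚ + sgn a * x)
        ≡⟨ solve 2 (λ σ y → :- (con 0ℚ :+ σ :* y) := (:- σ) :* y) refl (sgn a) x ⟩
      sgn (suc a) * x ∎

    next-odd : even? (suc s) ≡ false
    next-odd = trans (even?-suc s) (cong not even)

    on-next-line : ∀ a b → a ℕ.+ b ≡ suc s → d a b ≡ sgn a * (fromℕ a * x)
    on-next-line zero    b refl =
      trans (d-0-odd b next-odd) (solve 1 (λ y → con 0ℚ := con 1ℚ :* (con 0ℚ :* y)) refl x)
    on-next-line (suc a) b eq   = begin
      d (suc a) b
        ≡⟨ d-suc a b ⟩
      - (d a b + d a (suc b))
        ≡⟨ cong₂ (λ p q → - (p + q))
                 (on-line a b (ℕₚ.suc-injective eq)) (on-next-line a (suc b) (trans (ℕₚ.+-suc a b) eq)) ⟩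
      - (sgn a * x + sgn a * (fromℕ a * x))
        ≡⟨ solve 3 (λ σ n y → :- (σ :* y :+ σ :* (n :* y)) := (:- σ) :* ((con 1ℚ :+ n) :* y))
                 refl (sgn a) (fromℕ a) x ⟩
      sgn (suc a) * ((1ℚ + fromℕ a) * x)
        ≡⟨ cong (λ n → sgn (suc a) * (n * x)) (fromℕ-homo-+ 1 a) ⟨
      sgn (suc a) * (fromℕ (suc a) * x) ∎

    x≡0 : x ≡ 0ℚ
    x≡0 = p*q≡0⇒q≡0 (fromℕ (suc s)) (n*1/n≡1 (suc s))
            (p*q≡0⇒q≡0 (sgn (suc s)) (sgn*sgn≡1 (suc s)) (begin
      sgn (suc s) * (fromℕ (suc s) * x)  ≡⟨ on-next-line (suc s) 0 (ℕₚ.+-identityʳ (suc s)) ⟨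
      d (suc s) 0                        ≡⟨ d-comm (suc s) 0 ⟩
      d 0 (suc s)                        ≡⟨ d-0-odd (suc s) next-odd ⟩
      0ℚ                                 ∎))

  vanishes-before : ∀ s → VanishesBefore s
  vanishes-on : ∀ s → VanishesOn s

  vanishes-before (suc s) a b eq = vanishes-on s a b (ℕₚ.suc-injective eq)
  vanishes-on s with even? s in parity
  ... | true  = even-line s parity (vanishes-before s)
  ... | false = odd-line s parity (vanishes-before s)

  vanishes : ∀ a b → d a b ≡ 0ℚ
  vanishes a b = vanishes-on (a ℕ.+ b) a b refl

A : ℕ → ℕ → ℚ
A = binomialSum B′

Δ : ℕ → ℕ → ℚ
Δ a b = sgn a * A a b + sgn b * A b a + sgn (a ℕ.+ b) * betaQ a b

Δ-suc : ∀ a b → Δ (suc a) b ≡ - (Δ a b + Δ a (suc b))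
Δ-suc a b = begin
  (- σa) * A (suc a) b + σb * A b (suc a) + (- σ) * β₁₀
    ≡⟨ cong (λ t → (- σa) * t + σb * A b (suc a) + (- σ) * β₁₀) (binomialSum-suc B′ a b) ⟩
  (- σa) * (A a b + A a (suc b)) + σb * A b (suc a) + (- σ) * β₁₀
    ≡⟨ solve 9 (λ σa σb σ x x′ y y′ β₀₁ β₁₀ →
         (:- σa) :* (x :+ x′) :+ σb :* y′ :+ (:- σ) :* β₁₀
         := :- (σa :* x :+ σb :* y :+ σ :* (β₁₀ :+ β₀₁)
                :+ (σa :* x′ :+ (:- σb) :* (y :+ y′) :+ (:- σ) :* β₀₁)))
         refl σa σb σ (A a b) (A a (suc b)) (A b a) (A b (suc a)) β₀₁ β₁₀ ⟩
  - (σa * A a b + σb * A b a + σ * (β₁₀ + β₀₁)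
     + (σa * A a (suc b) + (- σb) * (A b a + A b (suc a)) + (- σ) * β₀₁))
    ≡⟨ cong₂ (λ β y → - (σa * A a b + σb * A b a + σ * β + (σa * A a (suc b) + (- σb) * y + (- σ) * β₀₁)))
             (betaQ-pascal a b) (sym (binomialSum-suc B′ b a)) ⟩
  - (Δ a b + (σa * A a (suc b) + sgn (suc b) * A (suc b) a + sgn (suc (a ℕ.+ b)) * β₀₁))
    ≡⟨ cong (λ t → - (Δ a b + (σa * A a (suc b) + sgn (suc b) * A (suc b) a + sgn t * β₀₁))) (ℕₚ.+-suc a b) ⟨
  - (Δ a b + Δ a (suc b)) ∎
  where
  σa  = sgn a
  σb  = sgn b
  σ   = sgn (a ℕ.+ b)
  β₁₀ = betaQ (suc a) b
  β₀₁ = betaQ a (suc b)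

Δ-comm : ∀ a b → Δ a b ≡ Δ b a
Δ-comm a b = cong₂ _+_ (ℚₚ.+-comm (sgn a * A a b) (sgn b * A b a))
                       (cong₂ _*_ (cong sgn (ℕₚ.+-comm a b)) (betaQ-comm a b))

Δ-0-suc : ∀ n → Δ 0 (suc n) ≡ (1ℚ + sgn (suc n)) * B′ (suc n)
Δ-0-suc n = begin
  1ℚ * A 0 b + σ * A b 0 + σ * betaQ 0 b
    ≡⟨ cong₂ (λ x y → 1ℚ * x + σ * y + σ * betaQ 0 b) (binomialSum-zero B′ b) (binomialSum-B′-suc-0 n) ⟩
  1ℚ * B′ b + σ * (B′ b - U) + σ * betaQ 0 b
    ≡⟨ cong (λ β → 1ℚ * B′ b + σ * (B′ b - U) + σ * β) (betaQ-0 b) ⟩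
  1ℚ * B′ b + σ * (B′ b - U) + σ * U
    ≡⟨ solve 3 (λ x σ u → con 1ℚ :* x :+ σ :* (x :- u) :+ σ :* u := (con 1ℚ :+ σ) :* x) refl (B′ b) σ U ⟩
  (1ℚ + σ) * B′ b ∎
  where
  b = suc n
  σ = sgn b
  U = + 1 / suc b

Δ-0-odd : ∀ b → even? b ≡ false → Δ 0 b ≡ 0ℚ
Δ-0-odd (suc n) odd = begin
  Δ 0 (suc n)                      ≡⟨ Δ-0-suc n ⟩
  (1ℚ + sgn (suc n)) * B′ (suc n)  ≡⟨ cong (λ σ → (1ℚ + σ) * B′ (suc n)) (sgn-odd (suc n) odd) ⟩
  (1ℚ - 1ℚ) * B′ (suc n)           ≡⟨ ℚₚ.*-zeroˡ (B′ (suc n)) ⟩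
  0ℚ                               ∎

open AntiDiagonal Δ Δ-suc Δ-comm Δ-0-odd using () renaming (vanishes to Δ≡0)

reflection : ∀ a b → even? (a ℕ.+ b) ≡ false → sgn a * A a b + sgn b * A b a ≡ betaQ a b
reflection a b odd = begin
  sgn a * A a b + sgn b * A b a
    ≡⟨ solve 3 (λ y σ β → y := (y :+ σ :* β) :- σ :* β) refl (sgn a * A a b + sgn b * A b a) σ (betaQ a b) ⟩
  Δ a b - σ * betaQ a b
    ≡⟨ cong₂ (λ δ s → δ - s * betaQ a b) (Δ≡0 a b) (sgn-odd (a ℕ.+ b) odd) ⟩
  0ℚ - (- 1ℚ) * betaQ a b
    ≡⟨ solve 1 (λ β → con 0ℚ :- (:- con 1ℚ) :* β := β) refl (betaQ a b) ⟩
  betaQ a b ∎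
  where
  σ = sgn (a ℕ.+ b)

B′-even-suc≡0 : ∀ n → even? (suc n) ≡ true → B′ (suc n) ≡ 0ℚ
B′-even-suc≡0 n even = p*q≡0⇒q≡0 (1ℚ + 1ℚ) {+ 1 / 2} refl (begin
  (1ℚ + 1ℚ) * B′ (suc n)           ≡⟨ cong (λ σ → (1ℚ + σ) * B′ (suc n)) (sgn-even (suc n) even) ⟨
  (1ℚ + sgn (suc n)) * B′ (suc n)  ≡⟨ Δ-0-suc n ⟨
  Δ 0 (suc n)                      ≡⟨ Δ≡0 0 (suc n) ⟩
  0ℚ                               ∎)

ζneg-summand : ∀ k j c → even? (k ℕ.+ suc j) ≡ false →
               (if even? k then c * ζneg (suc j) else 0ℚ) ≡ - (c * B′ (suc j))
ζneg-summand k j c odd with even? k in k-parity | even?-+ k (suc j)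
... | true  | k+j-parity = begin
  c * ζneg (suc j)
    ≡⟨ cong (c *_) (ζneg≡sgn*B′ (suc j)) ⟩
  c * (sgn (suc j) * B′ (suc j))
    ≡⟨ cong (λ σ → c * (σ * B′ (suc j))) (sgn-odd (suc j) (trans (sym k+j-parity) odd)) ⟩
  c * (- 1ℚ * B′ (suc j))
    ≡⟨ solve 2 (λ c x → c :* (:- con 1ℚ :* x) := :- (c :* x)) refl c (B′ (suc j)) ⟩
  - (c * B′ (suc j)) ∎
... | false | k+j-parity = begin
  0ℚ
    ≡⟨ solve 1 (λ c → con 0ℚ := :- (c :* con 0ℚ)) refl c ⟩
  - (c * 0ℚ)
    ≡⟨ cong (λ x → - (c * x)) (B′-even-suc≡0 j (not-injective (trans (sym k+j-parity) odd))) ⟨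
  - (c * B′ (suc j)) ∎

R-odd : ∀ m n → even? (suc m ℕ.+ n) ≡ false →
        R (suc m) n ≡ sgn n * betaQ (suc m) n + (B′ (suc m ℕ.+ n) - A n (suc m))
R-odd m n odd = cong (_+_ (sgn n * betaQ (suc m) n)) (begin
  Σ< n (λ i → if even? (suc i) then fromℕ (n C suc i) * ζneg (M ℕ.+ n ℕ.∸ suc i) else 0ℚ)
    ≡⟨ Σ<-cong n (λ i i<n → summand (suc i) i<n) ⟩
  Σ< n (λ i → - g (suc i))
    ≡⟨ Σ<-neg n (λ i → g (suc i)) ⟩
  - Σ< n (λ i → g (suc i))
    ≡⟨ solve 2 (λ x t → :- t := x :- (con 1ℚ :* x :+ t)) refl (B′ (M ℕ.+ n)) (Σ< n (λ i → g (suc i))) ⟩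
  B′ (M ℕ.+ n) - (g 0 + Σ< n (λ i → g (suc i)))
    ≡⟨ cong (_-_ (B′ (M ℕ.+ n))) (trans (binomialSum-reverse B′ n M) (Σ<-head n g)) ⟨
  B′ (M ℕ.+ n) - A n M ∎)
  where
  M = suc m
  g : ℕ → ℚ
  g k = fromℕ (n C k) * B′ (M ℕ.+ n ℕ.∸ k)
  summand : ∀ k → k ≤ n → (if even? k then fromℕ (n C k) * ζneg (M ℕ.+ n ℕ.∸ k) else 0ℚ) ≡ - g k
  summand k k≤n rewrite ℕₚ.+-∸-assoc M k≤n =
    ζneg-summand k (m ℕ.+ (n ℕ.∸ k)) (fromℕ (n C k)) (trans (cong even? k+[M+[n∸k]]≡M+n) odd)
    where
    k+[M+[n∸k]]≡M+n : k ℕ.+ (M ℕ.+ (n ℕ.∸ k)) ≡ M ℕ.+ n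
    k+[M+[n∸k]]≡M+n = trans (x∙yz≈y∙xz k M (n ℕ.∸ k)) (cong (M ℕ.+_) (ℕₚ.m+[n∸m]≡n k≤n))

theorem4p3 : (m n : ℕ) → .{{NonZero m}} → .{{NonZero n}} → (m Data.Nat.+ n) % 2 ≡ 1 →
    sgn n * R m n + sgn m * R n m ≡ betaQ m n
theorem4p3 zero    _       _ = contradiction refl (ℕ.≢-nonZero⁻¹ 0)
theorem4p3 (suc _) zero    _ = contradiction refl (ℕ.≢-nonZero⁻¹ 0)
theorem4p3 (suc m) (suc n) M+N%2≡1 = begin
  σN * R M N + σM * R N M
    ≡⟨ cong₂ (λ r r′ → σN * r + σM * r′) (R-odd m N odd) (R-odd n M odd′) ⟩
  σN * (σN * β + (X - A N M)) + σM * (σM * betaQ N M + (B′ (N ℕ.+ M) - A M N))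
    ≡⟨ cong₂ (λ β′ s → σN * (σN * β + (X - A N M)) + σM * (σM * β′ + (B′ s - A M N)))
             (betaQ-comm N M) (ℕₚ.+-comm N M) ⟩
  σN * (σN * β + (X - A N M)) + σM * (σM * β + (X - A M N))
    ≡⟨ solve 6 (λ σN σM β X y y′ →
         σN :* (σN :* β :+ (X :- y′)) :+ σM :* (σM :* β :+ (X :- y))
         := (σN :* σN :+ σM :* σM) :* β :+ (σM :+ σN) :* X :- (σM :* y :+ σN :* y′))
         refl σN σM β X (A M N) (A N M) ⟩
  (σN * σN + σM * σM) * β + (σM + σN) * X - (σM * A M N + σN * A N M)
    ≡⟨ cong₂ (λ c s → c * β + s * X - (σM * A M N + σN * A N M))
             (cong₂ _+_ (sgn*sgn≡1 N) (sgn*sgn≡1 M)) (sgn-+-odd M N odd) ⟩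
  (1ℚ + 1ℚ) * β + 0ℚ * X - (σM * A M N + σN * A N M)
    ≡⟨ cong (λ y → (1ℚ + 1ℚ) * β + 0ℚ * X - y) (reflection M N odd) ⟩
  (1ℚ + 1ℚ) * β + 0ℚ * X - β
    ≡⟨ solve 2 (λ β X → (con 1ℚ :+ con 1ℚ) :* β :+ con 0ℚ :* X :- β := β) refl β X ⟩
  β ∎
  where
  M  = suc m
  N  = suc n
  σM = sgn M
  σN = sgn N
  β  = betaQ M N
  X  = B′ (M ℕ.+ N)
  odd : even? (M ℕ.+ N) ≡ false
  odd = n%2≡1⇒odd (M ℕ.+ N) M+N%2≡1
  odd′ : even? (N ℕ.+ M) ≡ false
  odd′ = trans (cong even? (ℕₚ.+-comm N M)) odd
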